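{- None of the following schemes is derivable in $\mathsf{IELE}$, i.e. each has an instance not belonging to $\mathsf{IELE}$: (a) $(\varphi\rightsquigarrow\psi)\to\Box(\varphi\to\psi)$; (b) $(\varphi\to\Box\psi)\to(\varphi\rightsquigarrow\psi)$; (c) the converse of intuitionistic reflection, $\neg\neg(\varphi\to\psi)\to(\varphi\rightsquigarrow\psi)$.
   Context: Formulas: $\varphi::=p\mid\top\mid\bot\mid\varphi\wedge\varphi\mid\varphi\vee\varphi\mid\varphi\to\varphi\mid\varphi\rightsquigarrow\varphi$; $\neg\varphi:=\varphi\to\bot$, $\Box\varphi:=\top\rightsquigarrow\varphi$. $\mathsf{IELE}$ is the smallest set of formulas containing all theorems of intuitionistic propositional logic and all instances of $((\varphi\rightsquigarrow\psi)\wedge(\varphi\rightsquigarrow\chi))\to(\varphi\rightsquigarrow(\psi\wedge\chi))$, $((\varphi\rightsquigarrow\chi)\wedge(\psi\rightsquigarrow\chi))\to((\varphi\vee\psi)\rightsquigarrow\chi)$, $((\varphi\rightsquigarrow\psi)\wedge(\psi\rightsquigarrow\chi))\to(\varphi\rightsquigarrow\chi)$, $(\varphi\to\psi)\to(\varphi\rightsquigarrow\psi)$ and $(\varphi\rightsquigarrow\psi)\to\neg\neg(\varphi\to\psi)$, closed under modus ponens, the rule from $\varphi\to\psi$ infer $\varphi\rightsquigarrow\psi$, and uniform substitution. -}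

module Defs where

open import Data.Nat using (ℕ)

data Fm : Set where
  var  : ℕ → Fm
  ⊤'   : Fm
  ⊥'   : Fm
  _∧'_ : Fm → Fm → Fm
  _∨'_ : Fm → Fm → Fm
  _⇒_  : Fm → Fm → Fm
  _⇝_  : Fm → Fm → Fm

infixr 6 _∧'_
infixr 5 _∨'_
infixr 4 _⇒_
infixr 4 _⇝_

¬' : Fm → Fm
¬' φ = φ ⇒ ⊥'

□ : Fm → Fm
□ φ = ⊤' ⇝ φ

subst : (ℕ → Fm) → Fm → Fm
subst σ (var n)  = σ n
subst σ ⊤'       = ⊤'
subst σ ⊥'       = ⊥'
subst σ (φ ∧' ψ) = subst σ φ ∧' subst σ ψ
subst σ (φ ∨' ψ) = subst σ φ ∨' subst σ ψ
subst σ (φ ⇒ ψ)  = subst σ φ ⇒ subst σ ψ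
subst σ (φ ⇝ ψ)  = subst σ φ ⇝ subst σ ψ

-- Theorems of intuitionistic propositional logic in the full language
-- (formulas built with ⇝ are treated as atoms by the propositional axioms),
-- given by a standard Hilbert-style axiomatisation with modus ponens.
data IPC : Fm → Set where
  k     : ∀ {φ ψ} → IPC (φ ⇒ ψ ⇒ φ)
  s     : ∀ {φ ψ χ} → IPC ((φ ⇒ ψ ⇒ χ) ⇒ (φ ⇒ ψ) ⇒ φ ⇒ χ)
  ∧-e₁  : ∀ {φ ψ} → IPC (φ ∧' ψ ⇒ φ)
  ∧-e₂  : ∀ {φ ψ} → IPC (φ ∧' ψ ⇒ ψ)
  ∧-i   : ∀ {φ ψ} → IPC (φ ⇒ ψ ⇒ φ ∧' ψ)
  ∨-i₁  : ∀ {φ ψ} → IPC (φ ⇒ φ ∨' ψ)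
  ∨-i₂  : ∀ {φ ψ} → IPC (ψ ⇒ φ ∨' ψ)
  ∨-e   : ∀ {φ ψ χ} → IPC ((φ ⇒ χ) ⇒ (ψ ⇒ χ) ⇒ φ ∨' ψ ⇒ χ)
  ⊥-e   : ∀ {φ} → IPC (⊥' ⇒ φ)
  ⊤-i   : IPC ⊤'
  mp    : ∀ {φ ψ} → IPC (φ ⇒ ψ) → IPC φ → IPC ψ

data IELE : Fm → Set where
  ipc   : ∀ {φ} → IPC φ → IELE φ
  ax-∧  : ∀ {φ ψ χ} → IELE ((φ ⇝ ψ) ∧' (φ ⇝ χ) ⇒ (φ ⇝ (ψ ∧' χ)))
  ax-∨  : ∀ {φ ψ χ} → IELE ((φ ⇝ χ) ∧' (ψ ⇝ χ) ⇒ ((φ ∨' ψ) ⇝ χ))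
  ax-tr : ∀ {φ ψ χ} → IELE ((φ ⇝ ψ) ∧' (ψ ⇝ χ) ⇒ (φ ⇝ χ))
  ax-ip : ∀ {φ ψ} → IELE ((φ ⇒ ψ) ⇒ (φ ⇝ ψ))
  ax-re : ∀ {φ ψ} → IELE ((φ ⇝ ψ) ⇒ ¬' (¬' (φ ⇒ ψ)))
  mp    : ∀ {φ ψ} → IELE (φ ⇒ ψ) → IELE φ → IELE ψ
  nec   : ∀ {φ ψ} → IELE (φ ⇒ ψ) → IELE (φ ⇝ ψ)
  sub   : ∀ {φ} (σ : ℕ → Fm) → IELE φ → IELE (subst σ φ)

{-# OPTIONS --safe #-}

-- IELE is sound for Heyting algebras with an extra binary operation ↝ obeying
-- the inequalities that the ⇝-axioms express (necessitation then follows from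
-- x ⇨ y ≤ x ↝ y), a formula being valid when it evaluates to ⊤. All three
-- schemes are refuted on the four-element chain c₀ < c₁ < c₂ < c₃: the converse
-- of reflection by taking ↝ to be ⇨ itself, since c₃ ⇨ c₁ = c₁ lies strictly
-- below its double negation c₃, and (a), (b) by two operations read off from
-- Kripke frames.

module Submission where

open import Defs
open import Algebra.Core using (Op₂)
open import Data.Empty using (⊥-elim)
open import Data.Fin using (Fin; zero; suc; fromℕ)
open import Data.Fin.Properties using (≤-decTotalOrder; ≤fromℕ; all?)
open import Data.Nat using (ℕ; zero; suc; z≤n)
open import Data.Product using (Σ; _×_; _,_)
open import Level using (_⊔_)
open import Relation.Binary.Bundles using (DecTotalOrder)
open import Relation.Binary.Definitions using (Maximum; Minimum)
open import Relation.Binary.Lattice using (HeytingAlgebra)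
open import Relation.Nullary using (¬_; Dec; yes; no)
open import Relation.Nullary.Decidable using (from-yes; from-no; map′; _×-dec_)
import Relation.Binary.PropositionalEquality as ≡

module BoundedChain {a ℓ₁ ℓ₂} (O : DecTotalOrder a ℓ₁ ℓ₂)
  (top bot : DecTotalOrder.Carrier O)
  (top-max : Maximum (DecTotalOrder._≤_ O) top) (bot-min : Minimum (DecTotalOrder._≤_ O) bot) where

  open DecTotalOrder O
  open import Relation.Binary.Properties.DecTotalOrder O using (≰⇒≥)

  infixr 5 _⇨_
  infixr 6 _∨_
  infixr 7 _∧_

  _∧_ : Op₂ Carrier
  x ∧ y with x ≤? y
  ... | yes _ = x
  ... | no  _ = y

  _∨_ : Op₂ Carrier
  x ∨ y with x ≤? y
  ... | yes _ = y
  ... | no  _ = x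

  _⇨_ : Op₂ Carrier
  x ⇨ y with x ≤? y
  ... | yes _ = top
  ... | no  _ = y

  x∧y≤x : ∀ x y → x ∧ y ≤ x
  x∧y≤x x y with x ≤? y
  ... | yes _   = refl
  ... | no  x≰y = ≰⇒≥ x≰y

  x∧y≤y : ∀ x y → x ∧ y ≤ y
  x∧y≤y x y with x ≤? y
  ... | yes x≤y = x≤y
  ... | no  _   = refl

  ∧-greatest : ∀ {w x y} → w ≤ x → w ≤ y → w ≤ x ∧ y
  ∧-greatest {w} {x} {y} w≤x w≤y with x ≤? y
  ... | yes _ = w≤x
  ... | no  _ = w≤y

  x≤x∨y : ∀ x y → x ≤ x ∨ y
  x≤x∨y x y with x ≤? y
  ... | yes x≤y = x≤y
  ... | no  _   = refl

  y≤x∨y : ∀ x y → y ≤ x ∨ y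
  y≤x∨y x y with x ≤? y
  ... | yes _   = refl
  ... | no  x≰y = ≰⇒≥ x≰y

  ∨-least : ∀ {x y z} → x ≤ z → y ≤ z → x ∨ y ≤ z
  ∨-least {x} {y} x≤z y≤z with x ≤? y
  ... | yes _ = y≤z
  ... | no  _ = x≤z

  curry : ∀ {w x y} → w ∧ x ≤ y → w ≤ x ⇨ y
  curry {w} {x} {y} w∧x≤y with x ≤? y
  ... | yes _   = top-max w
  ... | no  x≰y with w ≤? x
  ...   | yes _ = w∧x≤y
  ...   | no  _ = ⊥-elim (x≰y w∧x≤y)

  uncurry : ∀ {w x y} → w ≤ x ⇨ y → w ∧ x ≤ y
  uncurry {w} {x} {y} w≤x⇨y with x ≤? y
  ... | yes x≤y = trans (x∧y≤y w x) x≤y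
  ... | no  _   = trans (x∧y≤x w x) w≤x⇨y

  heytingAlgebra : HeytingAlgebra a ℓ₁ ℓ₂
  heytingAlgebra = record
    { _∨_ = _∨_
    ; _∧_ = _∧_
    ; _⇨_ = _⇨_
    ; ⊤ = top
    ; ⊥ = bot
    ; isHeytingAlgebra = record
      { isBoundedLattice = record
        { isLattice = record
          { isPartialOrder = isPartialOrder
          ; supremum = λ x y → x≤x∨y x y , y≤x∨y x y , λ _ → ∨-least
          ; infimum = λ x y → x∧y≤x x y , x∧y≤y x y , λ _ → ∧-greatest
          }
        ; maximum = top-max
        ; minimum = bot-min
        }
      ; exponential = λ _ _ _ → curry , uncurry
      }
    }

module HeytingSemantics {c ℓ₁ ℓ₂} (H : HeytingAlgebra c ℓ₁ ℓ₂) where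

  open HeytingAlgebra H
  open import Relation.Binary.Lattice.Properties.HeytingAlgebra H
    using (⇨-eval; y≤x⇨y; x≤¬¬x; ⇨-distribˡ-∧-≥; ⇨-distribˡ-∨-∧-≥)
    renaming (¬_ to ∼_)
  open import Relation.Binary.Lattice.Properties.MeetSemilattice meetSemilattice
    using (∧-monotonic)

  ≤⇒⊤≤⇨ : ∀ {x y} → x ≤ y → ⊤ ≤ x ⇨ y
  ≤⇒⊤≤⇨ x≤y = transpose-⇨ (trans (x∧y≤y _ _) x≤y)

  ⊤≤⇨-mp : ∀ {x y} → ⊤ ≤ x ⇨ y → ⊤ ≤ x → ⊤ ≤ y
  ⊤≤⇨-mp ⊤≤x⇨y ⊤≤x = trans (∧-greatest ⊤≤x⇨y ⊤≤x) ⇨-eval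

  ⇨-trans : ∀ x y z → (x ⇨ y) ∧ (y ⇨ z) ≤ x ⇨ z
  ⇨-trans x y z = transpose-⇨ (trans (∧-greatest
    (trans (x∧y≤x _ _) (x∧y≤y _ _))
    (trans (∧-monotonic (x∧y≤x _ _) refl) ⇨-eval)) ⇨-eval)

  ⇨-distribˡ-⇨-≤ : ∀ x y z → x ⇨ y ⇨ z ≤ (x ⇨ y) ⇨ x ⇨ z
  ⇨-distribˡ-⇨-≤ x y z = transpose-⇨ (transpose-⇨ (trans (∧-greatest
    (trans (∧-monotonic (x∧y≤x _ _) refl) ⇨-eval)
    (trans (∧-monotonic (x∧y≤y _ _) refl) ⇨-eval)) ⇨-eval))

  record IsIELEOperator (_↝_ : Op₂ Carrier) : Set (c ⊔ ℓ₂) where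
    field
      ↝-distribˡ-∧ : ∀ x y z → (x ↝ y) ∧ (x ↝ z) ≤ x ↝ (y ∧ z)
      ↝-distribʳ-∨ : ∀ x y z → (x ↝ z) ∧ (y ↝ z) ≤ (x ∨ y) ↝ z
      ↝-trans      : ∀ x y z → (x ↝ y) ∧ (y ↝ z) ≤ x ↝ z
      ⇨≤↝          : ∀ x y → x ⇨ y ≤ x ↝ y
      ↝≤¬¬⇨        : ∀ x y → x ↝ y ≤ ∼ ∼ (x ⇨ y)

  ⇨-isIELEOperator : IsIELEOperator _⇨_
  ⇨-isIELEOperator = record
    { ↝-distribˡ-∧ = ⇨-distribˡ-∧-≥
    ; ↝-distribʳ-∨ = ⇨-distribˡ-∨-∧-≥
    ; ↝-trans      = ⇨-trans
    ; ⇨≤↝          = λ _ _ → refl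
    ; ↝≤¬¬⇨        = λ x y → x≤¬¬x (x ⇨ y)
    }

  Valuation : Set c
  Valuation = ℕ → Carrier

  module _ (_↝_ : Op₂ Carrier) where

    ⟦_⟧ : Fm → Valuation → Carrier
    ⟦ var n  ⟧ v = v n
    ⟦ ⊤'     ⟧ v = ⊤
    ⟦ ⊥'     ⟧ v = ⊥
    ⟦ φ ∧' ψ ⟧ v = ⟦ φ ⟧ v ∧ ⟦ ψ ⟧ v
    ⟦ φ ∨' ψ ⟧ v = ⟦ φ ⟧ v ∨ ⟦ ψ ⟧ v
    ⟦ φ ⇒ ψ  ⟧ v = ⟦ φ ⟧ v ⇨ ⟦ ψ ⟧ v
    ⟦ φ ⇝ ψ  ⟧ v = ⟦ φ ⟧ v ↝ ⟦ ψ ⟧ v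

    ⟦subst⟧ : ∀ σ φ v → ⟦ subst σ φ ⟧ v ≡.≡ ⟦ φ ⟧ (λ n → ⟦ σ n ⟧ v)
    ⟦subst⟧ σ (var n)  v = ≡.refl
    ⟦subst⟧ σ ⊤'       v = ≡.refl
    ⟦subst⟧ σ ⊥'       v = ≡.refl
    ⟦subst⟧ σ (φ ∧' ψ) v = ≡.cong₂ _∧_ (⟦subst⟧ σ φ v) (⟦subst⟧ σ ψ v)
    ⟦subst⟧ σ (φ ∨' ψ) v = ≡.cong₂ _∨_ (⟦subst⟧ σ φ v) (⟦subst⟧ σ ψ v)
    ⟦subst⟧ σ (φ ⇒ ψ)  v = ≡.cong₂ _⇨_ (⟦subst⟧ σ φ v) (⟦subst⟧ σ ψ v)
    ⟦subst⟧ σ (φ ⇝ ψ)  v = ≡.cong₂ _↝_ (⟦subst⟧ σ φ v) (⟦subst⟧ σ ψ v)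

    Valid : Fm → Set (c ⊔ ℓ₂)
    Valid φ = ∀ v → ⊤ ≤ ⟦ φ ⟧ v

    IPC-sound : ∀ {φ} → IPC φ → Valid φ
    IPC-sound k        v = ≤⇒⊤≤⇨ y≤x⇨y
    IPC-sound s        v = ≤⇒⊤≤⇨ (⇨-distribˡ-⇨-≤ _ _ _)
    IPC-sound ∧-e₁     v = ≤⇒⊤≤⇨ (x∧y≤x _ _)
    IPC-sound ∧-e₂     v = ≤⇒⊤≤⇨ (x∧y≤y _ _)
    IPC-sound ∧-i      v = ≤⇒⊤≤⇨ (transpose-⇨ refl)
    IPC-sound ∨-i₁     v = ≤⇒⊤≤⇨ (x≤x∨y _ _)
    IPC-sound ∨-i₂     v = ≤⇒⊤≤⇨ (y≤x∨y _ _)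
    IPC-sound ∨-e      v = ≤⇒⊤≤⇨ (transpose-⇨ (⇨-distribˡ-∨-∧-≥ _ _ _))
    IPC-sound ⊥-e      v = ≤⇒⊤≤⇨ (minimum _)
    IPC-sound ⊤-i      v = refl
    IPC-sound (mp d e) v = ⊤≤⇨-mp (IPC-sound d v) (IPC-sound e v)

    module _ (isIELE : IsIELEOperator _↝_) where

      open IsIELEOperator isIELE

      IELE-sound : ∀ {φ} → IELE φ → Valid φ
      IELE-sound (ipc d)   v = IPC-sound d v
      IELE-sound ax-∧      v = ≤⇒⊤≤⇨ (↝-distribˡ-∧ _ _ _)
      IELE-sound ax-∨      v = ≤⇒⊤≤⇨ (↝-distribʳ-∨ _ _ _)
      IELE-sound ax-tr     v = ≤⇒⊤≤⇨ (↝-trans _ _ _)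
      IELE-sound ax-ip     v = ≤⇒⊤≤⇨ (⇨≤↝ _ _)
      IELE-sound ax-re     v = ≤⇒⊤≤⇨ (↝≤¬¬⇨ _ _)
      IELE-sound (mp d e)  v = ⊤≤⇨-mp (IELE-sound d v) (IELE-sound e v)
      IELE-sound (nec d)   v = trans (IELE-sound d v) (⇨≤↝ _ _)
      IELE-sound (sub {φ} σ d) v =
        ≡.subst (⊤ ≤_) (≡.sym (⟦subst⟧ σ φ v)) (IELE-sound d _)

      IELE-refute : ∀ φ v → ¬ (⊤ ≤ ⟦ φ ⟧ v) → ¬ IELE φ
      IELE-refute φ v ⊤≰⟦φ⟧ d = ⊤≰⟦φ⟧ (IELE-sound d v)

module FiniteChain (n : ℕ) where

  open BoundedChain (≤-decTotalOrder (suc n)) (fromℕ n) zero ≤fromℕ (λ _ → z≤n) public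
  open HeytingSemantics heytingAlgebra public
  open DecTotalOrder (≤-decTotalOrder (suc n)) using (_≤?_)

  isIELEOperator? : (_↝_ : Op₂ (Fin (suc n))) → Dec (IsIELEOperator _↝_)
  isIELEOperator? _↝_ = map′
    (λ (∧ʳ , ∨ˡ , tr , ⇨≤ , ≤¬¬) → record
      { ↝-distribˡ-∧ = ∧ʳ ; ↝-distribʳ-∨ = ∨ˡ ; ↝-trans = tr ; ⇨≤↝ = ⇨≤ ; ↝≤¬¬⇨ = ≤¬¬ })
    (λ isIELE → let open IsIELEOperator isIELE in
      ↝-distribˡ-∧ , ↝-distribʳ-∨ , ↝-trans , ⇨≤↝ , ↝≤¬¬⇨)
    (     all³? (λ x y z → (x ↝ y) ∧ (x ↝ z) ≤? x ↝ (y ∧ z))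
    ×-dec all³? (λ x y z → (x ↝ z) ∧ (y ↝ z) ≤? (x ∨ y) ↝ z)
    ×-dec all³? (λ x y z → (x ↝ y) ∧ (y ↝ z) ≤? x ↝ z)
    ×-dec all²? (λ x y → x ⇨ y ≤? x ↝ y)
    ×-dec all²? (λ x y → x ↝ y ≤? ((x ⇨ y) ⇨ zero) ⇨ zero))
    where
    C = Fin (suc n)
    all²? : {P : C → C → Set} → (∀ x y → Dec (P x y)) → Dec (∀ x y → P x y)
    all²? P? = all? λ x → all? λ y → P? x y
    all³? : {P : C → C → C → Set} → (∀ x y z → Dec (P x y z)) → Dec (∀ x y z → P x y z)
    all³? P? = all? λ x → all? λ y → all? λ z → P? x y z

open FiniteChain 3
open DecTotalOrder (≤-decTotalOrder 4) using (_≤?_)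

pattern c₀ = zero
pattern c₁ = suc c₀
pattern c₂ = suc c₁
pattern c₃ = suc c₂

-- On the upsets of the frame w₀ < w₁ < w₂ (the upset with k worlds being cₖ),
-- x ↝ y is the set of worlds w such that every E-successor of every v ≥ w
-- lying in x lies in y, with E = {w₀w₀, w₁w₂, w₂w₂} for ↝ᵃ and
-- E = {w₀w₀, w₀w₁, w₁w₂, w₂w₂} for ↝ᵇ.
_↝ᵃ_ : Op₂ (Fin 4)
c₁ ↝ᵃ c₀ = c₀
c₂ ↝ᵃ c₀ = c₀
c₃ ↝ᵃ c₀ = c₀
c₃ ↝ᵃ c₁ = c₂
c₃ ↝ᵃ c₂ = c₂
_  ↝ᵃ _  = c₃

_↝ᵇ_ : Op₂ (Fin 4)
c₁ ↝ᵇ c₀ = c₀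
c₂ ↝ᵇ c₀ = c₀
c₃ ↝ᵇ c₀ = c₀
c₂ ↝ᵇ c₁ = c₂
c₃ ↝ᵇ c₁ = c₂
c₃ ↝ᵇ c₂ = c₂
_  ↝ᵇ _  = c₃

↝ᵃ-isIELEOperator : IsIELEOperator _↝ᵃ_
↝ᵃ-isIELEOperator = from-yes (isIELEOperator? _↝ᵃ_)

↝ᵇ-isIELEOperator : IsIELEOperator _↝ᵇ_
↝ᵇ-isIELEOperator = from-yes (isIELEOperator? _↝ᵇ_)

p q : Fm
p = var 0
q = var 1

[p≔_,q≔_] : Fin 4 → Fin 4 → Valuation
[p≔ x ,q≔ y ] zero    = x
[p≔ x ,q≔ y ] (suc _) = y

proposition3p10 : (Σ Fm λ φ → Σ Fm λ ψ → ¬ IELE ((φ ⇝ ψ) ⇒ □ (φ ⇒ ψ)))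
    × (Σ Fm λ φ → Σ Fm λ ψ → ¬ IELE ((φ ⇒ □ ψ) ⇒ (φ ⇝ ψ)))
    × (Σ Fm λ φ → Σ Fm λ ψ → ¬ IELE (¬' (¬' (φ ⇒ ψ)) ⇒ (φ ⇝ ψ)))
proposition3p10 =
    (p , q , IELE-refute _↝ᵃ_ ↝ᵃ-isIELEOperator _ [p≔ c₂ ,q≔ c₁ ] (from-no (c₃ ≤? c₂)))
  , (p , q , IELE-refute _↝ᵇ_ ↝ᵇ-isIELEOperator _ [p≔ c₂ ,q≔ c₁ ] (from-no (c₃ ≤? c₂)))
  , (p , q , IELE-refute _⇨_ ⇨-isIELEOperator _ [p≔ c₃ ,q≔ c₁ ] (from-no (c₃ ≤? c₁)))
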